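{- Let $\mathcal{G}=(G_0,\dots,G_{p-1})$ be a periodic graph with footprint $G$ and let $h:G\to H$ be a retraction of $G$ onto a subgraph $H$. If for every time $t$, $h(G_t)$ is a retract of $G_t$, then $c(\mathcal{G}[H])\le c(\mathcal{G})$.
   Context: All graphs are finite, undirected and reflexive. A retraction of a graph $G$ onto a subgraph $H$ is a graph homomorphism $h:G\to H$ (edges map to edges, loops allowed as images) that is the identity on $H$; $H$ is a retract of $G$; $h(G_t)$ denotes the image of the subgraph $G_t$ under $h$. A periodic graph with period $p\ge1$ is a sequence $\mathcal{G}=(G_0,\dots,G_{p-1})$ of graphs $G_i=(V,E_i)$ on a common vertex set, extended by $G_{i+p}=G_i$; its footprint is $G=(V,\bigcup_iE_i)$, assumed connected. For $H\subseteq G$, $\mathcal{G}[H]=(G_0[V(H)],\dots,G_{p-1}[V(H)])$. Cops and Robber on a periodic graph with $k$ cops (perfect information): cops choose starting vertices, then the robber; in each round $t=0,1,\dots$ each cop moves to a vertex of $N_{G_{t\bmod p}}[\text{its position}]$, then the robber likewise; the cops win if a cop ever moves onto the robber's vertex. The cop number $c(\cdot)$ is the least $k$ such that $k$ cops have a winning strategy. -}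

module Defs where

open import Data.Nat using (ℕ; zero; suc)
open import Data.Nat.DivMod using (_mod_)
open import Data.Fin using (Fin)
open import Data.Fin.Subset using (Subset; _∈_)
open import Data.Product using (Σ; ∃; ∃₂; _×_; _,_)
open import Data.Sum using (_⊎_)
open import Relation.Binary.PropositionalEquality using (_≡_)
open import Relation.Binary.Construct.Closure.ReflexiveTransitive using (Star)

record Graph (V : Set) : Set₁ where
  field
    Adj      : V → V → Set
    adj-refl : ∀ v → Adj v v
    adj-sym  : ∀ {u v} → Adj u v → Adj v u
open Graph public

Connected : ∀ {V} → Graph V → Set
Connected {V} G = ∀ (u v : V) → Star (Adj G) u v

record PeriodicGraph (V : Set) : Set₁ where
  field
    q     : ℕ
    layer : Fin (suc q) → Graph V
  period : ℕ
  period = suc q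
  at : ℕ → Graph V
  at t = layer (t mod suc q)
open PeriodicGraph public

footprint : ∀ {V} → PeriodicGraph V → Graph V
footprint 𝒢 = record
  { Adj = λ u v → ∃ λ i → Adj (layer 𝒢 i) u v
  ; adj-refl = λ v → Data.Fin.zero , adj-refl (layer 𝒢 Data.Fin.zero) v
  ; adj-sym = λ { (i , e) → i , adj-sym (layer 𝒢 i) e } }

InducedV : ∀ {n} → Subset n → Set
InducedV {n} S = Σ (Fin n) (λ v → v ∈ S)

induced : ∀ {n} → Graph (Fin n) → (S : Subset n) → Graph (InducedV S)
induced G S = record
  { Adj = λ { (u , _) (v , _) → Adj G u v }
  ; adj-refl = λ { (v , _) → adj-refl G v }
  ; adj-sym = λ { {u , _} {v , _} e → adj-sym G e } }

_[_] : ∀ {n} → PeriodicGraph (Fin n) → (S : Subset n) → PeriodicGraph (InducedV S)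
𝒢 [ S ] = record { q = q 𝒢 ; layer = λ i → induced (layer 𝒢 i) S }

record SubgraphData (V : Set) : Set₁ where
  field
    Vert : V → Set
    Edge : V → V → Set
open SubgraphData public

record IsSubgraph {V} (G : Graph V) (H : SubgraphData V) : Set where
  field
    edge⊆    : ∀ {u v} → Edge H u v → Adj G u v
    edge-ends : ∀ {u v} → Edge H u v → Vert H u × Vert H v
    edge-refl : ∀ {v} → Vert H v → Edge H v v
    edge-sym  : ∀ {u v} → Edge H u v → Edge H v u

record Retraction {V} (G : Graph V) (H : SubgraphData V) : Set where
  field
    map  : V → V
    into : ∀ v → Vert H (map v)
    hom  : ∀ {u v} → Adj G u v → Edge H (map u) (map v)
    fix  : ∀ {v} → Vert H v → map v ≡ v
open Retraction public

IsRetract : ∀ {V} → Graph V → SubgraphData V → Set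
IsRetract G H = IsSubgraph G H × Retraction G H

mkSub : ∀ {n} → Subset n → (Fin n → Fin n → Set) → SubgraphData (Fin n)
mkSub S E = record { Vert = λ v → v ∈ S ; Edge = E }

image : ∀ {V} → (V → V) → Graph V → SubgraphData V
image h G = record
  { Vert = λ a → ∃ λ u → h u ≡ a
  ; Edge = λ a b → ∃₂ λ u v → Adj G u v × h u ≡ a × h v ≡ b }

module _ {V : Set} (𝒢 : PeriodicGraph V) (k : ℕ) where

  Cops : Set
  Cops = Fin k → V

  CopMove : ℕ → Cops → Cops → Set
  CopMove t cs cs' = ∀ i → Adj (at 𝒢 t) (cs i) (cs' i)

  Caught : Cops → V → Set
  Caught cs r = ∃ λ i → cs i ≡ r

  -- CopWinFrom t cs r : at the start of round t, cops at cs, robber at r,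
  -- the cops can force a capture in finitely many rounds.
  data CopWinFrom : ℕ → Cops → V → Set where
    move : ∀ {t cs r} (cs' : Cops) → CopMove t cs cs' →
           (Caught cs' r ⊎ (∀ r' → Adj (at 𝒢 t) r r' → CopWinFrom (suc t) cs' r')) →
           CopWinFrom t cs r

  CopsWin : Set
  CopsWin = Σ Cops λ cs → ∀ r → CopWinFrom zero cs r

{-# OPTIONS --safe #-}
module Submission where

open import Defs
open import Data.Nat using (ℕ; suc)
open import Data.Nat.DivMod using (_mod_)
open import Data.Fin using (Fin)
open import Data.Fin.Subset using (Subset)
open import Data.Vec.Properties.WithK using ([]=-irrelevant)
open import Data.Product using (_,_; proj₁)
open import Data.Sum using (_⊎_; inj₁; inj₂)
open import Function using (_∘_)
open import Relation.Binary.PropositionalEquality using (_≡_; refl; cong; trans)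

-- The cops on 𝒢[H] play the h-shadow of a winning strategy on 𝒢, treating the robber
-- on H as a robber on 𝒢. Because h(G_t) ⊆ G_t, the shadow of a move along G_t is a
-- move along G_t inside H; because h fixes H, a capture on 𝒢 casts a capture on 𝒢[H].

module _ {V W : Set} (𝒢 : PeriodicGraph V) (ℋ : PeriodicGraph W)
         (f : V → W) (g : W → V)
         (f-hom : ∀ t {u v} → Adj (at 𝒢 t) u v → Adj (at ℋ t) (f u) (f v))
         (g-hom : ∀ t {a b} → Adj (at ℋ t) a b → Adj (at 𝒢 t) (g a) (g b))
         (f∘g≡id : ∀ a → f (g a) ≡ a)
         (k : ℕ) where

  CopWinFrom-shadow : ∀ {t cs r} → CopWinFrom 𝒢 k t cs (g r) →
                      CopWinFrom ℋ k t (f ∘ cs) r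
  CopWinFrom-shadow {t} {r = r} (move cs′ step outcome) =
    move (f ∘ cs′) (λ i → f-hom t (step i)) (shadow-outcome outcome)
    where
    shadow-outcome :
      Caught 𝒢 k cs′ (g r) ⊎ (∀ r′ → Adj (at 𝒢 t) (g r) r′ → CopWinFrom 𝒢 k (suc t) cs′ r′) →
      Caught ℋ k (f ∘ cs′) r ⊎ (∀ r′ → Adj (at ℋ t) r r′ → CopWinFrom ℋ k (suc t) (f ∘ cs′) r′)
    shadow-outcome (inj₁ (i , cs′i≡gr)) = inj₁ (i , trans (cong f cs′i≡gr) (f∘g≡id r))
    shadow-outcome (inj₂ continue) =
      inj₂ λ r′ r→r′ → CopWinFrom-shadow (continue (g r′) (g-hom t r→r′))

  CopsWin-retract : CopsWin 𝒢 k → CopsWin ℋ k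
  CopsWin-retract (cs , win) = f ∘ cs , λ r → CopWinFrom-shadow (win (g r))

module _ {n} (𝒢 : PeriodicGraph (Fin n)) (S : Subset n) (E : Fin n → Fin n → Set)
         (h : Retraction (footprint 𝒢) (mkSub S E)) where

  restrict : Fin n → InducedV S
  restrict v = map h v , into h v

  restrict-section : ∀ (a : InducedV S) → restrict (proj₁ a) ≡ a
  restrict-section (a , a∈S) with map h a | into h a | fix h a∈S
  ... | .a | ha∈S | refl = cong (a ,_) ([]=-irrelevant ha∈S a∈S)

  restrict-hom : (∀ i → IsSubgraph (layer 𝒢 i) (image (map h) (layer 𝒢 i))) →
                 ∀ t {u v} → Adj (at 𝒢 t) u v → Adj (at (𝒢 [ S ]) t) (restrict u) (restrict v)
  restrict-hom image⊆ t {u} {v} e =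
    IsSubgraph.edge⊆ (image⊆ (t mod period 𝒢)) (u , v , e , refl , refl)

theorem2 : ∀ {n} (𝒢 : PeriodicGraph (Fin n)) → Connected (footprint 𝒢) →
    (S : Subset n) (E : Fin n → Fin n → Set) →
    IsSubgraph (footprint 𝒢) (mkSub S E) →
    (h : Retraction (footprint 𝒢) (mkSub S E)) →
    (∀ (i : Fin (period 𝒢)) → IsRetract (layer 𝒢 i) (image (map h) (layer 𝒢 i))) →
    ∀ (k : ℕ) → CopsWin 𝒢 k → CopsWin (𝒢 [ S ]) k
theorem2 𝒢 _ S E _ h retracts =
  CopsWin-retract 𝒢 (𝒢 [ S ]) (restrict 𝒢 S E h) proj₁
    (restrict-hom 𝒢 S E h (proj₁ ∘ retracts)) (λ _ e → e) (restrict-section 𝒢 S E h)
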